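{- Let $q$ be a positive integer and $A_q=(c_q(m-n))_{m,n=1}^q$. Then for every positive integer $j$, $\mathrm{tr}(A_q^j)=q^j\varphi(q)$.
   Context: For a positive integer $q$ and any integer $n$, the Ramanujan sum is $c_q(n)=\sum_{1\le k\le q,\ \gcd(k,q)=1}\exp(2\pi i kn/q)$. $\varphi$ is Euler's totient function and $\mathrm{tr}$ denotes the trace. -}

module Defs where

open import Level using (Level)
open import Data.Nat as ℕ using (ℕ; zero; suc; NonZero)
open import Data.Fin using (Fin; toℕ) renaming (zero to fzero; suc to fsuc)
open import Data.Integer as ℤ using (ℤ)
open import Data.Integer.DivMod using (_%ℕ_)
open import Data.Nat.Coprimality using (Coprime; coprime?)
open import Data.Sum using (_⊎_)
open import Data.Empty using (⊥)
open import Data.Product using (_×_)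
import Data.Fin
open import Relation.Nullary using (yes; no)
open import Algebra.Bundles using (CommutativeRing)

φ : ℕ → ℕ
φ q = go q
  where
  go : ℕ → ℕ
  go zero = zero
  go (suc k) with coprime? (suc k) q
  ... | yes _ = suc (go k)
  ... | no  _ = go k

module _ {c ℓ : Level} (R : CommutativeRing c ℓ) where
  open CommutativeRing R

  pow : Carrier → ℕ → Carrier
  pow x zero    = 1#
  pow x (suc n) = x * pow x n

  fromℕ : ℕ → Carrier
  fromℕ zero    = 0#
  fromℕ (suc n) = 1# + fromℕ n

  sumFin : (n : ℕ) → (Fin n → Carrier) → Carrier
  sumFin zero    f = 0#
  sumFin (suc n) f = f fzero + sumFin n (λ i → f (fsuc i))

  NoZeroDivisors : Set (c Level.⊔ ℓ)
  NoZeroDivisors = ∀ x y → x * y ≈ 0# → (x ≈ 0#) ⊎ (y ≈ 0#)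

  IsPrimitiveRoot : ℕ → Carrier → Set ℓ
  IsPrimitiveRoot q ζ =
    (pow ζ q ≈ 1#) × (∀ k → 0 ℕ.< k → k ℕ.< q → pow ζ k ≈ 1# → ⊥)

  -- ζ^z for an integer z, valid when ζ^q = 1 (exponent reduced mod q)
  zpow : (q : ℕ) .{{_ : NonZero q}} → Carrier → ℤ → Carrier
  zpow q ζ z = pow ζ (z %ℕ q)

  -- Ramanujan sum c_q(n) = Σ_{1≤k≤q, gcd(k,q)=1} ζ^{kn}, where ζ = e^{2πi/q}
  ramanujan : (q : ℕ) .{{_ : NonZero q}} → Carrier → ℤ → Carrier
  ramanujan q ζ n = sumFin q term
    where
    term : Fin q → Carrier
    term i with coprime? (suc (toℕ i)) q
    ... | yes _ = zpow q ζ (ℤ.+ (suc (toℕ i)) ℤ.* n)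
    ... | no  _ = 0#

  Matrix : ℕ → Set c
  Matrix q = Fin q → Fin q → Carrier

  idMat : (q : ℕ) → Matrix q
  idMat q i j with i Data.Fin.≟ j
  ... | yes _ = 1#
  ... | no  _ = 0#

  mulMat : (q : ℕ) → Matrix q → Matrix q → Matrix q
  mulMat q A B i j = sumFin q (λ k → A i k * B k j)

  powMat : (q : ℕ) → Matrix q → ℕ → Matrix q
  powMat q A zero    = idMat q
  powMat q A (suc j) = mulMat q A (powMat q A j)

  trace : (q : ℕ) → Matrix q → Carrier
  trace q A = sumFin q (λ i → A i i)

  -- A_q = (c_q(m - n))_{m,n=1}^q  (index i : Fin q stands for i+1)
  ramanujanMatrix : (q : ℕ) .{{_ : NonZero q}} → Carrier → Matrix q
  ramanujanMatrix q ζ m n =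
    ramanujan q ζ (ℤ.+ (toℕ m) ℤ.- ℤ.+ (toℕ n))

{-# OPTIONS --safe #-}
module Submission where

-- Since c_q(m − n) = Σ_{k ⊥ q} ζ^{km} ζ^{−kn}, the matrix A_q factors as
-- Uᵀ D V with U_{km} = ζ^{km}, V_{kn} = ζ^{−kn} and D the 0/1 diagonal matrix
-- of the units mod q. By orthogonality V Uᵀ = q I: for k ≠ l the root of unity
-- y = ζ^{l−k} is not 1, so (y − 1)(1 + y + ⋯ + y^{q−1}) = y^q − 1 = 0 forces
-- the geometric sum to vanish in a ring without zero divisors. As D² = D this
-- gives A_q² = q A_q, hence A_q^j = q^{j−1} A_q, while tr A_q = q φ(q).

open import Defs
open import Level using (Level)
open import Function.Base using (_∘_)
open import Data.Empty using (⊥-elim)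
open import Data.Product.Base using (proj₁; proj₂)
open import Data.Sum.Base using (inj₁; inj₂)
open import Data.Nat.Base as ℕ using (ℕ; zero; suc; NonZero; pred; _<_; _≤_; _∸_)
import Data.Nat.Properties as ℕₚ
open import Data.Fin.Base as Fin using (Fin; toℕ; punchIn) renaming (zero to fzero; suc to fsuc)
import Data.Fin.Properties as Finₚ
open import Data.Integer.Base as ℤ using (ℤ; +_; -[1+_])
import Data.Integer.Properties as ℤₚ
open import Data.Integer.DivMod using (_%ℕ_; _/ℕ_; a≡a%ℕn+[a/ℕn]*n)
open import Data.Integer.Tactic.RingSolver using (solve-∀)
open import Data.Nat.Coprimality using (coprime?)
open import Relation.Nullary using (Dec; yes; no; ¬_)
open import Relation.Binary.PropositionalEquality as ≡ using (_≡_; _≢_)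
open import Relation.Binary.Definitions using (tri<; tri≈; tri>)
open import Algebra.Bundles using (CommutativeRing)

tally : ∀ {p} {P : Set p} → Dec P → ℕ → ℕ
tally (yes _) n = suc n
tally (no _)  n = n

-- The counting function of φ is local to its where block; the metavariable
-- coprimeCount is solved by unification with it, which gives it a name.
mutual
  coprimeCount : ℕ → ℕ → ℕ
  coprimeCount = _

  φ-suc : ∀ q → φ (suc q) ≡ tally (coprime? (suc q) (suc q)) (coprimeCount (suc q) q)
  φ-suc q with coprime? (suc q) (suc q)
  ... | yes _ with suc q
  ...   | _ = ≡.refl
  φ-suc q | no _ with suc q
  ...   | _ = ≡.refl

coprimeCount-suc : ∀ q k → coprimeCount q (suc k) ≡ tally (coprime? (suc k) q) (coprimeCount q k)
coprimeCount-suc q k with coprime? (suc k) q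
... | yes _ = ≡.refl
... | no _  = ≡.refl

φ≡coprimeCount : ∀ q → φ q ≡ coprimeCount q q
φ≡coprimeCount zero    = ≡.refl
φ≡coprimeCount (suc q) = ≡.trans (φ-suc q) (≡.sym (coprimeCount-suc (suc q) q))

+a≡+b+k*q⇒a≡b+k*q : ∀ a b k q → + a ≡ + b ℤ.+ + k ℤ.* + q → a ≡ b ℕ.+ k ℕ.* q
+a≡+b+k*q⇒a≡b+k*q a b k q a≡ = ℤₚ.+-injective (begin
  + a                     ≡⟨ a≡ ⟩
  + b ℤ.+ + k ℤ.* + q     ≡⟨ ≡.cong (λ e → + b ℤ.+ e) (ℤₚ.pos-* k q) ⟨
  + b ℤ.+ + (k ℕ.* q)     ≡⟨ ℤₚ.pos-+ b (k ℕ.* q) ⟨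
  + (b ℕ.+ k ℕ.* q)       ∎)
  where open ≡.≡-Reasoning

a≡b+t*q⇒b≡a+[-t]*q : ∀ a b t q → a ≡ b ℤ.+ t ℤ.* q → b ≡ a ℤ.+ (ℤ.- t) ℤ.* q
a≡b+t*q⇒b≡a+[-t]*q _ b t q ≡.refl = move b t q
  where
  move : ∀ b t q → b ≡ (b ℤ.+ t ℤ.* q) ℤ.+ (ℤ.- t) ℤ.* q
  move = solve-∀

+a≡z+b⇒+a≡+[r+b]+t*q : ∀ z a b r t q → z ≡ + r ℤ.+ t ℤ.* q → z ℤ.+ + b ≡ + a →
                       + a ≡ + (r ℕ.+ b) ℤ.+ t ℤ.* q
+a≡z+b⇒+a≡+[r+b]+t*q z a b r t q z≡ z+b≡a = begin
  + a                           ≡⟨ z+b≡a ⟨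
  z ℤ.+ + b                     ≡⟨ ≡.cong (λ e → e ℤ.+ + b) z≡ ⟩
  (+ r ℤ.+ t ℤ.* q) ℤ.+ + b     ≡⟨ regroup (+ r) (t ℤ.* q) (+ b) ⟩
  (+ r ℤ.+ + b) ℤ.+ t ℤ.* q     ≡⟨ ≡.cong (λ e → e ℤ.+ t ℤ.* q) (ℤₚ.pos-+ r b) ⟨
  + (r ℕ.+ b) ℤ.+ t ℤ.* q       ∎
  where
  open ≡.≡-Reasoning
  regroup : ∀ r s b → (r ℤ.+ s) ℤ.+ b ≡ (r ℤ.+ b) ℤ.+ s
  regroup = solve-∀

k*[m-n]+k*n≡k*m : ∀ k m n → + k ℤ.* (+ m ℤ.- + n) ℤ.+ + (k ℕ.* n) ≡ + (k ℕ.* m)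
k*[m-n]+k*n≡k*m k m n = begin
  + k ℤ.* (+ m ℤ.- + n) ℤ.+ + (k ℕ.* n)
    ≡⟨ ≡.cong (λ e → + k ℤ.* (+ m ℤ.- + n) ℤ.+ e) (ℤₚ.pos-* k n) ⟩
  + k ℤ.* (+ m ℤ.- + n) ℤ.+ + k ℤ.* + n   ≡⟨ distrib (+ k) (+ m) (+ n) ⟩
  + k ℤ.* + m                             ≡⟨ ℤₚ.pos-* k m ⟨
  + (k ℕ.* m)                             ∎
  where
  open ≡.≡-Reasoning
  distrib : ∀ k m n → k ℤ.* (m ℤ.- n) ℤ.+ k ℤ.* n ≡ k ℤ.* m
  distrib = solve-∀

module _ {c ℓ : Level} (R : CommutativeRing c ℓ) where
  open CommutativeRing R
  open import Algebra.Properties.Semiring.Sum semiring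
  open import Algebra.Properties.Semiring.Exp semiring
  open import Algebra.Properties.Semiring.Mult semiring using (_×_; ×1-homo-*)
  open import Algebra.Properties.CommutativeSemiring.Exp commutativeSemiring using (^-distrib-*)
  open import Algebra.Properties.CommutativeSemigroup *-commutativeSemigroup
    using (x∙yz≈y∙xz; x∙yz≈yx∙z)
  open import Algebra.Properties.Group +-group using (∙-cancelʳ; x∙y⁻¹≈ε⇒x≈y)
  open import Algebra.Properties.Ring ring using (-1*x≈-x)
  open import Relation.Binary.Reasoning.Setoid setoid

  sumFin≡sum : ∀ n (f : Fin n → Carrier) → sumFin R n f ≡ sum f
  sumFin≡sum zero    f = ≡.refl
  sumFin≡sum (suc n) f = ≡.cong (_+_ (f fzero)) (sumFin≡sum n (f ∘ fsuc))

  pow≡^ : ∀ x n → pow R x n ≡ x ^ n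
  pow≡^ x zero    = ≡.refl
  pow≡^ x (suc n) = ≡.cong (x *_) (pow≡^ x n)

  fromℕ≡× : ∀ n → fromℕ R n ≡ n × 1#
  fromℕ≡× zero    = ≡.refl
  fromℕ≡× (suc n) = ≡.cong (_+_ 1#) (fromℕ≡× n)

  1^n≈1 : ∀ n → 1# ^ n ≈ 1#
  1^n≈1 zero    = refl
  1^n≈1 (suc n) = trans (*-identityˡ _) (1^n≈1 n)

  ×1-homo-^ : ∀ m n → (m ℕ.^ n) × 1# ≈ (m × 1#) ^ n
  ×1-homo-^ m zero    = +-identityʳ 1#
  ×1-homo-^ m (suc n) = trans (×1-homo-* m (m ℕ.^ n)) (*-congˡ (×1-homo-^ m n))

  sum-*-sum : ∀ {m n} (f : Fin m → Carrier) (g : Fin n → Carrier) →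
              sum f * sum g ≈ sum (λ k → sum (λ l → f k * g l))
  sum-*-sum f g = trans (*-distribʳ-sum (sum g) f) (sum-cong-≋ (λ k → *-distribˡ-sum (f k) g))

  sum-single : ∀ {n} (f : Fin n → Carrier) k → (∀ l → l ≢ k → f l ≈ 0#) → sum f ≈ f k
  sum-single {suc n} f k f≈0 = begin
    sum f                           ≈⟨ sum-remove {i = k} f ⟩
    f k + ∑[ l < n ] f (punchIn k l)
      ≈⟨ +-congˡ (sum-cong-≋ (λ l → f≈0 _ (Finₚ.punchInᵢ≢i k l))) ⟩
    f k + ∑[ l < n ] 0#             ≈⟨ +-congˡ (sum-replicate-zero n) ⟩
    f k + 0#                        ≈⟨ +-identityʳ (f k) ⟩
    f k                             ∎

  idMat-diag : ∀ {n} (i : Fin n) → idMat R n i i ≈ 1#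
  idMat-diag i with i Finₚ.≟ i
  ... | yes _  = refl
  ... | no i≢i = ⊥-elim (i≢i ≡.refl)

  idMat-off : ∀ {n} {i j : Fin n} → i ≢ j → idMat R n i j ≈ 0#
  idMat-off {i = i} {j} i≢j with i Finₚ.≟ j
  ... | yes i≡j = ⊥-elim (i≢j i≡j)
  ... | no _    = refl

  mulMat≡sum : ∀ {n} (A B : Matrix R n) i j → mulMat R n A B i j ≡ sum (λ k → A i k * B k j)
  mulMat≡sum {n} A B i j = sumFin≡sum n _

  mulMat-identityʳ : ∀ {n} (A : Matrix R n) i j → mulMat R n A (idMat R n) i j ≈ A i j
  mulMat-identityʳ {n} A i j = begin
    mulMat R n A (idMat R n) i j       ≡⟨ mulMat≡sum A (idMat R n) i j ⟩
    ∑[ k < n ] (A i k * idMat R n k j)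
      ≈⟨ sum-single _ j (λ k k≢j → trans (*-congˡ (idMat-off k≢j)) (zeroʳ _)) ⟩
    A i j * idMat R n j j              ≈⟨ *-congˡ (idMat-diag j) ⟩
    A i j * 1#                         ≈⟨ *-identityʳ _ ⟩
    A i j                              ∎

  module _ {n} (A : Matrix R n) (c : Carrier)
           (A²≈cA : ∀ i j → ∑[ k < n ] (A i k * A k j) ≈ c * A i j) where

    powMat-suc : ∀ t i j → powMat R n A (suc t) i j ≈ c ^ t * A i j
    powMat-suc zero    i j = trans (mulMat-identityʳ A i j) (sym (*-identityˡ _))
    powMat-suc (suc t) i j = begin
      mulMat R n A (powMat R n A (suc t)) i j  ≡⟨ mulMat≡sum A (powMat R n A (suc t)) i j ⟩
      ∑[ k < n ] (A i k * powMat R n A (suc t) k j)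
        ≈⟨ sum-cong-≋ (λ k → trans (*-congˡ (powMat-suc t k j)) (x∙yz≈y∙xz _ _ _)) ⟩
      ∑[ k < n ] (c ^ t * (A i k * A k j))     ≈⟨ *-distribˡ-sum (c ^ t) (λ k → A i k * A k j) ⟨
      c ^ t * ∑[ k < n ] (A i k * A k j)       ≈⟨ *-congˡ (A²≈cA i j) ⟩
      c ^ t * (c * A i j)                      ≈⟨ x∙yz≈yx∙z _ _ _ ⟩
      c ^ suc t * A i j                        ∎

    trace-powMat-suc : ∀ t → trace R n (powMat R n A (suc t)) ≈ c ^ t * trace R n A
    trace-powMat-suc t = begin
      trace R n (powMat R n A (suc t))      ≡⟨ sumFin≡sum n _ ⟩
      ∑[ i < n ] powMat R n A (suc t) i i   ≈⟨ sum-cong-≋ (λ i → powMat-suc t i i) ⟩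
      ∑[ i < n ] (c ^ t * A i i)            ≈⟨ *-distribˡ-sum (c ^ t) (λ i → A i i) ⟨
      c ^ t * ∑[ i < n ] A i i              ≡⟨ ≡.cong (c ^ t *_) (sumFin≡sum n _) ⟨
      c ^ t * trace R n A                   ∎

  module Biorthogonal {n} (u v : Fin n → Fin n → Carrier) (c : Carrier)
           (orth-diag : ∀ k → ∑[ p < n ] (v k p * u k p) ≈ c)
           (orth-off : ∀ k l → k ≢ l → ∑[ p < n ] (v k p * u l p) ≈ 0#)
           (w : Fin n → Carrier) where

    M : Fin n → Fin n → Carrier
    M i j = ∑[ k < n ] (w k * (u k i * v k j))

    pull-scalar : ∀ k l x → ∑[ p < n ] (x * (v k p * u l p)) ≈ x * ∑[ p < n ] (v k p * u l p)
    pull-scalar k l x = sym (*-distribˡ-sum x (λ p → v k p * u l p))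

    M-square : (∀ k → w k * w k ≈ w k) → ∀ i j → ∑[ p < n ] (M i p * M p j) ≈ c * M i j
    M-square w-idem i j = begin
      ∑[ p < n ] (M i p * M p j)
        ≈⟨ sum-cong-≋ (λ p → sum-*-sum (λ k → left k p) (λ l → right l p)) ⟩
      ∑[ p < n ] ∑[ k < n ] ∑[ l < n ] (left k p * right l p)
        ≈⟨ ∑-comm (λ p k → ∑[ l < n ] (left k p * right l p)) ⟩
      ∑[ k < n ] ∑[ p < n ] ∑[ l < n ] (left k p * right l p)
        ≈⟨ sum-cong-≋ (λ k → ∑-comm (λ p l → left k p * right l p)) ⟩
      ∑[ k < n ] ∑[ l < n ] ∑[ p < n ] (left k p * right l p)
        ≈⟨ sum-cong-≋ (λ k → sum-cong-≋ (λ l →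
             trans (sum-cong-≋ (λ p → rearrange k l p)) (pull-scalar k l (coeff k l)))) ⟩
      ∑[ k < n ] ∑[ l < n ] (coeff k l * ∑[ p < n ] (v k p * u l p))
        ≈⟨ sum-cong-≋ (λ k → sum-single _ k (λ l l≢k →
             trans (*-congˡ (orth-off k l (l≢k ∘ ≡.sym))) (zeroʳ _))) ⟩
      ∑[ k < n ] (coeff k k * ∑[ p < n ] (v k p * u k p))
        ≈⟨ sum-cong-≋ (λ k → trans (*-cong (*-congʳ (w-idem k)) (orth-diag k)) (*-comm _ c)) ⟩
      ∑[ k < n ] (c * (w k * (u k i * v k j)))
        ≈⟨ *-distribˡ-sum c (λ k → w k * (u k i * v k j)) ⟨
      c * M i j ∎
      where
      left right : Fin n → Fin n → Carrier
      left k p = w k * (u k i * v k p)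
      right l p = w l * (u l p * v l j)
      coeff : Fin n → Fin n → Carrier
      coeff k l = (w k * w l) * (u k i * v l j)
      open import Algebra.Solver.CommutativeMonoid *-commutativeMonoid using (solve; _⊕_; _⊜_)
      rearrange : ∀ k l p → left k p * right l p ≈ coeff k l * (v k p * u l p)
      rearrange k l p = solve 6
        (λ a b x d e y → (a ⊕ (b ⊕ x)) ⊕ (d ⊕ (e ⊕ y)) ⊜ ((a ⊕ d) ⊕ (b ⊕ y)) ⊕ (x ⊕ e))
        refl (w k) (u k i) (v k p) (w l) (u l p) (v l j)

    trace-M : ∑[ i < n ] (M i i) ≈ c * sum w
    trace-M = begin
      ∑[ i < n ] ∑[ k < n ] (w k * (u k i * v k i))
        ≈⟨ ∑-comm (λ i k → w k * (u k i * v k i)) ⟩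
      ∑[ k < n ] ∑[ i < n ] (w k * (u k i * v k i))
        ≈⟨ sum-cong-≋ (λ k → trans (sum-cong-≋ (λ i → *-congˡ (*-comm (u k i) (v k i))))
                                   (pull-scalar k k (w k))) ⟩
      ∑[ k < n ] (w k * ∑[ i < n ] (v k i * u k i))
        ≈⟨ sum-cong-≋ (λ k → trans (*-congˡ (orth-diag k)) (*-comm _ c)) ⟩
      ∑[ k < n ] (c * w k)                ≈⟨ *-distribˡ-sum c w ⟨
      c * sum w                           ∎

  geometricSum : Carrier → ℕ → Carrier
  geometricSum y n = ∑[ p < n ] (y ^ toℕ p)

  geometricSum-vanishes : NoZeroDivisors R → ∀ {y n} → y ^ n ≈ 1# → ¬ y ≈ 1# → geometricSum y n ≈ 0#
  geometricSum-vanishes nzd {y} {n} yⁿ≈1 y≉1 with nzd (y - 1#) G [y-1]G≈0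
    where
    G = geometricSum y n
    -- both sides equal geometricSum y (suc n), split off at either end
    telescope : y * G + 1# ≈ G + 1#
    telescope = begin
      y * G + 1#               ≈⟨ +-comm _ _ ⟩
      1# + y * G               ≈⟨ +-congˡ (*-distribˡ-sum y (λ (p : Fin n) → y ^ toℕ p)) ⟩
      geometricSum y (suc n)   ≈⟨ sum-init-last {n} (λ p → y ^ toℕ p) ⟩
      ∑[ p < n ] (y ^ toℕ (Fin.inject₁ p)) + y ^ toℕ (Fin.fromℕ n)
        ≡⟨ ≡.cong₂ _+_ (sum-cong-≗ {n} (λ p → ≡.cong (y ^_) (Finₚ.toℕ-inject₁ p)))
                       (≡.cong (y ^_) (Finₚ.toℕ-fromℕ n)) ⟩
      G + y ^ n                ≈⟨ +-congˡ yⁿ≈1 ⟩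
      G + 1#                   ∎
    [y-1]G≈0 : (y - 1#) * G ≈ 0#
    [y-1]G≈0 = begin
      (y - 1#) * G             ≈⟨ distribʳ G y (- 1#) ⟩
      y * G + - 1# * G         ≈⟨ +-cong (∙-cancelʳ 1# _ _ telescope) (-1*x≈-x G) ⟩
      G - G                    ≈⟨ -‿inverseʳ G ⟩
      0#                       ∎
  ... | inj₁ y-1≈0 = ⊥-elim (y≉1 (x∙y⁻¹≈ε⇒x≈y y 1# y-1≈0))
  ... | inj₂ G≈0   = G≈0

  module _ (q : ℕ) where

    ^-periodic : ∀ {x} → x ^ q ≈ 1# → ∀ a k → x ^ (a ℕ.+ k ℕ.* q) ≈ x ^ a
    ^-periodic {x} x^q≈1 a k = begin
      x ^ (a ℕ.+ k ℕ.* q)                    ≈⟨ ^-homo-* x a _ ⟩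
      x ^ a * x ^ (k ℕ.* q)                  ≡⟨ ≡.cong (λ e → x ^ a * x ^ e) (ℕₚ.*-comm k q) ⟩
      x ^ a * x ^ (q ℕ.* k)                  ≈⟨ *-congˡ (^-assocʳ x q k) ⟨
      x ^ a * (x ^ q) ^ k                    ≈⟨ *-congˡ (trans (^-congˡ k x^q≈1) (1^n≈1 k)) ⟩
      x ^ a * 1#                             ≈⟨ *-identityʳ _ ⟩
      x ^ a                                  ∎

    root-^ : ∀ {x} → x ^ q ≈ 1# → ∀ a → (x ^ a) ^ q ≈ 1#
    root-^ {x} x^q≈1 a = trans (^-assocʳ x a q) (^-periodic x^q≈1 0 a)

    root-* : ∀ {x y} → x ^ q ≈ 1# → y ^ q ≈ 1# → (x * y) ^ q ≈ 1#
    root-* {x} {y} x^q≈1 y^q≈1 =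
      trans (^-distrib-* x y q) (trans (*-cong x^q≈1 y^q≈1) (*-identityʳ 1#))

    ^-cong-mod : ∀ {x} → x ^ q ≈ 1# → ∀ a b t → + a ≡ + b ℤ.+ t ℤ.* + q → x ^ a ≈ x ^ b
    ^-cong-mod x^q≈1 a b (+ k) a≡ =
      trans (reflexive (≡.cong (_ ^_) (+a≡+b+k*q⇒a≡b+k*q a b k q a≡))) (^-periodic x^q≈1 b k)
    ^-cong-mod x^q≈1 a b -[1+ k ] a≡ =
      sym (^-cong-mod x^q≈1 b a (+ suc k) (a≡b+t*q⇒b≡a+[-t]*q (+ a) (+ b) -[1+ k ] (+ q) a≡))

  coprimeIndicator : ℕ → ℕ → Carrier
  coprimeIndicator q k with coprime? (suc k) q
  ... | yes _ = 1#
  ... | no _  = 0#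

  coprimeIndicator-idem : ∀ q k → coprimeIndicator q k * coprimeIndicator q k ≈ coprimeIndicator q k
  coprimeIndicator-idem q k with coprime? (suc k) q
  ... | yes _ = *-identityʳ 1#
  ... | no _  = zeroʳ 0#

  tally-×1 : ∀ q k n → n × 1# + coprimeIndicator q k ≈ tally (coprime? (suc k) q) n × 1#
  tally-×1 q k n with coprime? (suc k) q
  ... | yes _ = +-comm _ 1#
  ... | no _  = +-identityʳ _

  sum-coprimeIndicator : ∀ q k → ∑[ i < k ] coprimeIndicator q (toℕ i) ≈ coprimeCount q k × 1#
  sum-coprimeIndicator q zero    = refl
  sum-coprimeIndicator q (suc k) = begin
    ∑[ i < suc k ] coprimeIndicator q (toℕ i)
      ≈⟨ sum-init-last (λ i → coprimeIndicator q (toℕ i)) ⟩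
    ∑[ i < k ] coprimeIndicator q (toℕ (Fin.inject₁ i)) + coprimeIndicator q (toℕ (Fin.fromℕ k))
      ≡⟨ ≡.cong₂ _+_ (sum-cong-≗ {k} (λ i → ≡.cong (coprimeIndicator q) (Finₚ.toℕ-inject₁ i)))
                     (≡.cong (coprimeIndicator q) (Finₚ.toℕ-fromℕ k)) ⟩
    ∑[ i < k ] coprimeIndicator q (toℕ i) + coprimeIndicator q k
      ≈⟨ +-congʳ (sum-coprimeIndicator q k) ⟩
    coprimeCount q k × 1# + coprimeIndicator q k          ≈⟨ tally-×1 q k _ ⟩
    tally (coprime? (suc k) q) (coprimeCount q k) × 1#   ≡⟨ ≡.cong (_× 1#) (coprimeCount-suc q k) ⟨
    coprimeCount q (suc k) × 1#                           ∎

  sum-coprimeIndicator≈φ : ∀ q → ∑[ i < q ] coprimeIndicator q (toℕ i) ≈ φ q × 1#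
  sum-coprimeIndicator≈φ q =
    trans (sum-coprimeIndicator q q) (reflexive (≡.cong (_× 1#) (≡.sym (φ≡coprimeCount q))))

  -- As for φ, this names the summand local to the definition of ramanujan.
  mutual
    ramanujanTerm : (q : ℕ) .{{_ : NonZero q}} → Carrier → ℤ → Fin q → Carrier
    ramanujanTerm = _

    ramanujan≡sumFin : ∀ q .{{_ : NonZero q}} ζ z →
                       ramanujan R q ζ z ≡ sumFin R q (ramanujanTerm q ζ z)
    ramanujan≡sumFin q ζ z = ≡.refl

  ramanujanTerm≈ : ∀ q .{{_ : NonZero q}} ζ z i → ramanujanTerm q ζ z i
                   ≈ coprimeIndicator q (toℕ i) * zpow R q ζ (+ suc (toℕ i) ℤ.* z)
  ramanujanTerm≈ q ζ z i with coprime? (suc (toℕ i)) q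
  ... | yes _ = sym (*-identityˡ _)
  ... | no _  = sym (zeroˡ _)

  module RootOfUnity (q : ℕ) .{{_ : NonZero q}} (ζ : Carrier) (ζ^q≈1 : ζ ^ q ≈ 1#) where

    ζ⁻¹ : Carrier
    ζ⁻¹ = ζ ^ pred q

    ζ*ζ⁻¹≈1 : ζ * ζ⁻¹ ≈ 1#
    ζ*ζ⁻¹≈1 = trans (reflexive (≡.cong (ζ ^_) (ℕₚ.suc-pred q))) ζ^q≈1

    ζ⁻¹^q≈1 : ζ⁻¹ ^ q ≈ 1#
    ζ⁻¹^q≈1 = root-^ q ζ^q≈1 (pred q)

    ζ^a*ζ⁻¹^a≈1 : ∀ a → ζ ^ a * ζ⁻¹ ^ a ≈ 1#
    ζ^a*ζ⁻¹^a≈1 a = trans (sym (^-distrib-* ζ ζ⁻¹ a)) (trans (^-congˡ a ζ*ζ⁻¹≈1) (1^n≈1 a))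

    ζ⁻¹^a*x≈1⇒x≈ζ^a : ∀ a {x} → ζ⁻¹ ^ a * x ≈ 1# → x ≈ ζ ^ a
    ζ⁻¹^a*x≈1⇒x≈ζ^a a {x} ζ⁻¹ᵃx≈1 = begin
      x                          ≈⟨ *-identityˡ x ⟨
      1# * x                     ≈⟨ *-congʳ (ζ^a*ζ⁻¹^a≈1 a) ⟨
      (ζ ^ a * ζ⁻¹ ^ a) * x      ≈⟨ *-assoc _ _ _ ⟩
      ζ ^ a * (ζ⁻¹ ^ a * x)      ≈⟨ *-congˡ ζ⁻¹ᵃx≈1 ⟩
      ζ ^ a * 1#                 ≈⟨ *-identityʳ _ ⟩
      ζ ^ a                      ∎

    ζ⁻¹*ζ^[1+a]≈ζ^a : ∀ a → ζ⁻¹ * ζ ^ suc a ≈ ζ ^ a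
    ζ⁻¹*ζ^[1+a]≈ζ^a a = begin
      ζ⁻¹ * (ζ * ζ ^ a)          ≈⟨ *-assoc ζ⁻¹ ζ _ ⟨
      (ζ⁻¹ * ζ) * ζ ^ a          ≈⟨ *-congʳ (trans (*-comm ζ⁻¹ ζ) ζ*ζ⁻¹≈1) ⟩
      1# * ζ ^ a                 ≈⟨ *-identityˡ _ ⟩
      ζ ^ a                      ∎

    zpow≈ : ∀ z a b → z ℤ.+ + b ≡ + a → zpow R q ζ z ≈ ζ ^ a * ζ⁻¹ ^ b
    zpow≈ z a b z+b≡a = begin
      zpow R q ζ z               ≡⟨ pow≡^ ζ r ⟩
      ζ ^ r                      ≈⟨ *-identityʳ _ ⟨
      ζ ^ r * 1#                 ≈⟨ *-congˡ (ζ^a*ζ⁻¹^a≈1 b) ⟨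
      ζ ^ r * (ζ ^ b * ζ⁻¹ ^ b)  ≈⟨ *-assoc _ _ _ ⟨
      (ζ ^ r * ζ ^ b) * ζ⁻¹ ^ b  ≈⟨ *-congʳ (^-homo-* ζ r b) ⟨
      ζ ^ (r ℕ.+ b) * ζ⁻¹ ^ b    ≈⟨ *-congʳ (^-cong-mod q ζ^q≈1 a (r ℕ.+ b) (z /ℕ q) a≡) ⟨
      ζ ^ a * ζ⁻¹ ^ b            ∎
      where
      r = z %ℕ q
      a≡ : + a ≡ + (r ℕ.+ b) ℤ.+ (z /ℕ q) ℤ.* + q
      a≡ = +a≡z+b⇒+a≡+[r+b]+t*q z a b r (z /ℕ q) (+ q) (a≡a%ℕn+[a/ℕn]*n z q) z+b≡a

    toℕ⁺ : Fin q → ℕ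
    toℕ⁺ i = suc (toℕ i)

    u v : Fin q → Fin q → Carrier
    u k m = ζ ^ (toℕ⁺ k ℕ.* toℕ m)
    v k n = ζ⁻¹ ^ (toℕ⁺ k ℕ.* toℕ n)

    χ : Fin q → Carrier
    χ k = coprimeIndicator q (toℕ k)

    ramanujanMatrix-expand : ∀ m n → ramanujanMatrix R q ζ m n ≈ ∑[ k < q ] (χ k * (u k m * v k n))
    ramanujanMatrix-expand m n = begin
      ramanujanMatrix R q ζ m n
        ≡⟨ ≡.trans (ramanujan≡sumFin q ζ z) (sumFin≡sum q (ramanujanTerm q ζ z)) ⟩
      sum (ramanujanTerm q ζ z)
        ≈⟨ sum-cong-≋ (λ k → trans (ramanujanTerm≈ q ζ z k)
                                   (*-congˡ (zpow≈ (+ toℕ⁺ k ℤ.* z) _ _ (k[m-n] k)))) ⟩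
      ∑[ k < q ] (χ k * (u k m * v k n)) ∎
      where
      z = + toℕ m ℤ.- + toℕ n
      k[m-n] : ∀ k → + toℕ⁺ k ℤ.* z ℤ.+ + (toℕ⁺ k ℕ.* toℕ n) ≡ + (toℕ⁺ k ℕ.* toℕ m)
      k[m-n] k = k*[m-n]+k*n≡k*m (toℕ⁺ k) (toℕ m) (toℕ n)

  module Primitive (nzd : NoZeroDivisors R) (q : ℕ) .{{_ : NonZero q}} (ζ : Carrier)
                   (isPrimitive : IsPrimitiveRoot R q ζ) where

    ζ^q≈1 : ζ ^ q ≈ 1#
    ζ^q≈1 = trans (reflexive (≡.sym (pow≡^ ζ q))) (proj₁ isPrimitive)

    open RootOfUnity q ζ ζ^q≈1

    ζ^b≉ζ^a : ∀ {a b} → a < b → b < q → ¬ ζ ^ b ≈ ζ ^ a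
    ζ^b≉ζ^a {a} {b} a<b b<q ζᵇ≈ζᵃ = proj₂ isPrimitive d (ℕₚ.m<n⇒0<n∸m a<b)
      (ℕₚ.≤-<-trans (ℕₚ.m∸n≤m b a) b<q) (trans (reflexive (pow≡^ ζ d)) ζᵈ≈1)
      where
      d = b ∸ a
      ζᵈ≈1 : ζ ^ d ≈ 1#
      ζᵈ≈1 = begin
        ζ ^ d                      ≈⟨ *-identityˡ _ ⟨
        1# * ζ ^ d                 ≈⟨ *-congʳ (trans (*-comm _ _) (ζ^a*ζ⁻¹^a≈1 a)) ⟨
        (ζ⁻¹ ^ a * ζ ^ a) * ζ ^ d  ≈⟨ *-assoc _ _ _ ⟩
        ζ⁻¹ ^ a * (ζ ^ a * ζ ^ d)  ≈⟨ *-congˡ (^-homo-* ζ a d) ⟨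
        ζ⁻¹ ^ a * ζ ^ (a ℕ.+ d)    ≡⟨ ≡.cong (λ e → ζ⁻¹ ^ a * ζ ^ e) (ℕₚ.m+[n∸m]≡n (ℕₚ.<⇒≤ a<b)) ⟩
        ζ⁻¹ ^ a * ζ ^ b            ≈⟨ *-congˡ ζᵇ≈ζᵃ ⟩
        ζ⁻¹ ^ a * ζ ^ a            ≈⟨ trans (*-comm _ _) (ζ^a*ζ⁻¹^a≈1 a) ⟩
        1#                         ∎

    ^-injective : ∀ {a b} → a < q → b < q → ζ ^ a ≈ ζ ^ b → a ≡ b
    ^-injective {a} {b} a<q b<q ζᵃ≈ζᵇ with ℕₚ.<-cmp a b
    ... | tri< a<b _ _ = ⊥-elim (ζ^b≉ζ^a a<b b<q (sym ζᵃ≈ζᵇ))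
    ... | tri≈ _ a≡b _ = a≡b
    ... | tri> _ _ b<a = ⊥-elim (ζ^b≉ζ^a b<a a<q ζᵃ≈ζᵇ)

    v*u≈ : ∀ k l p → v k p * u l p ≈ (ζ⁻¹ ^ toℕ⁺ k * ζ ^ toℕ⁺ l) ^ toℕ p
    v*u≈ k l p = begin
      v k p * u l p
        ≈⟨ *-cong (^-assocʳ ζ⁻¹ (toℕ⁺ k) (toℕ p)) (^-assocʳ ζ (toℕ⁺ l) (toℕ p)) ⟨
      (ζ⁻¹ ^ toℕ⁺ k) ^ toℕ p * (ζ ^ toℕ⁺ l) ^ toℕ p
        ≈⟨ ^-distrib-* (ζ⁻¹ ^ toℕ⁺ k) (ζ ^ toℕ⁺ l) (toℕ p) ⟨
      (ζ⁻¹ ^ toℕ⁺ k * ζ ^ toℕ⁺ l) ^ toℕ p ∎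

    orth-diag : ∀ k → ∑[ p < q ] (v k p * u k p) ≈ q × 1#
    orth-diag k = trans (sum-cong-≋ v*u≈1) (sum-replicate q)
      where
      v*u≈1 : ∀ p → v k p * u k p ≈ 1#
      v*u≈1 p = trans (*-comm (v k p) (u k p)) (ζ^a*ζ⁻¹^a≈1 (toℕ⁺ k ℕ.* toℕ p))

    orth-off : ∀ k l → k ≢ l → ∑[ p < q ] (v k p * u l p) ≈ 0#
    orth-off k l k≢l = trans (sum-cong-≋ (v*u≈ k l)) (geometricSum-vanishes nzd {n = q} y^q≈1 y≉1)
      where
      y^q≈1 : (ζ⁻¹ ^ toℕ⁺ k * ζ ^ toℕ⁺ l) ^ q ≈ 1#
      y^q≈1 = root-* q (root-^ q ζ⁻¹^q≈1 (toℕ⁺ k)) (root-^ q ζ^q≈1 (toℕ⁺ l))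
      y≉1 : ¬ ζ⁻¹ ^ toℕ⁺ k * ζ ^ toℕ⁺ l ≈ 1#
      y≉1 y≈1 = k≢l (Finₚ.toℕ-injective (^-injective (Finₚ.toℕ<n k) (Finₚ.toℕ<n l) ζᵏ≈ζˡ))
        where
        ζᵏ≈ζˡ : ζ ^ toℕ k ≈ ζ ^ toℕ l
        ζᵏ≈ζˡ = begin
          ζ ^ toℕ k         ≈⟨ ζ⁻¹*ζ^[1+a]≈ζ^a (toℕ k) ⟨
          ζ⁻¹ * ζ ^ toℕ⁺ k  ≈⟨ *-congˡ (ζ⁻¹^a*x≈1⇒x≈ζ^a (toℕ⁺ k) y≈1) ⟨
          ζ⁻¹ * ζ ^ toℕ⁺ l  ≈⟨ ζ⁻¹*ζ^[1+a]≈ζ^a (toℕ l) ⟩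
          ζ ^ toℕ l         ∎

    open Biorthogonal u v (q × 1#) orth-diag orth-off χ

    A : Matrix R q
    A = ramanujanMatrix R q ζ

    A²≈qA : ∀ m n → ∑[ p < q ] (A m p * A p n) ≈ (q × 1#) * A m n
    A²≈qA m n = begin
      ∑[ p < q ] (A m p * A p n)
        ≈⟨ sum-cong-≋ (λ p → *-cong (ramanujanMatrix-expand m p) (ramanujanMatrix-expand p n)) ⟩
      ∑[ p < q ] (M m p * M p n)  ≈⟨ M-square (coprimeIndicator-idem q ∘ toℕ) m n ⟩
      (q × 1#) * M m n            ≈⟨ *-congˡ (ramanujanMatrix-expand m n) ⟨
      (q × 1#) * A m n            ∎

    trace-A : trace R q A ≈ (q × 1#) * (φ q × 1#)
    trace-A = begin
      trace R q A                 ≡⟨ sumFin≡sum q (λ m → A m m) ⟩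
      ∑[ m < q ] A m m            ≈⟨ sum-cong-≋ (λ m → ramanujanMatrix-expand m m) ⟩
      ∑[ m < q ] M m m            ≈⟨ trace-M ⟩
      (q × 1#) * sum χ            ≈⟨ *-congˡ (sum-coprimeIndicator≈φ q) ⟩
      (q × 1#) * (φ q × 1#)       ∎

    trace-powMat-A : ∀ j → trace R q (powMat R q A (suc j)) ≈ fromℕ R (q ℕ.^ suc j ℕ.* φ q)
    trace-powMat-A j = begin
      trace R q (powMat R q A (suc j))        ≈⟨ trace-powMat-suc A (q × 1#) A²≈qA j ⟩
      (q × 1#) ^ j * trace R q A              ≈⟨ *-congˡ trace-A ⟩
      (q × 1#) ^ j * ((q × 1#) * (φ q × 1#))  ≈⟨ x∙yz≈yx∙z _ _ _ ⟩
      (q × 1#) ^ suc j * (φ q × 1#)           ≈⟨ *-congʳ (×1-homo-^ q (suc j)) ⟨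
      (q ℕ.^ suc j) × 1# * (φ q × 1#)         ≈⟨ ×1-homo-* (q ℕ.^ suc j) (φ q) ⟨
      (q ℕ.^ suc j ℕ.* φ q) × 1#              ≡⟨ fromℕ≡× (q ℕ.^ suc j ℕ.* φ q) ⟨
      fromℕ R (q ℕ.^ suc j ℕ.* φ q)           ∎

open import Data.Nat using (_^_; _*_)

lemma6 : {c ℓ : Level} (R : CommutativeRing c ℓ) → NoZeroDivisors R →
    (q : ℕ) .{{_ : NonZero q}} (ζ : CommutativeRing.Carrier R) →
    IsPrimitiveRoot R q ζ →
    (j : ℕ) → 1 ≤ j →
    CommutativeRing._≈_ R
      (trace R q (powMat R q (ramanujanMatrix R q ζ) j))
      (fromℕ R (q ^ j * φ q))
lemma6 R nzd q ζ isPrimitive (suc j) _ = Primitive.trace-powMat-A R nzd q ζ isPrimitive j
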